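{- For every integer $n\ge 0$, $$\sum_{k=0}^n\frac{\binom{n}{k}\binom{n+k}{k}\binom{2k}{k}}{(-4)^k(k+1)}=\frac{\binom{2\lfloor n/2\rfloor}{\lfloor n/2\rfloor}^2}{16^{\lfloor n/2\rfloor}}\cdot\begin{cases} 1 & \text{if $n$ is even},\\[1mm] \dfrac{n}{n+1} & \text{if $n$ is odd}.\end{cases}$$ -}

module Defs where

open import Data.Nat as ℕ using (ℕ; zero; suc; _+_; _*_; _^_; _/_; _%_; NonZero)
open import Data.Nat.Properties using (m*n≢0)
open import Data.Nat.Combinatorics using (_C_)
open import Data.Integer as ℤ using (ℤ; +_)
open import Data.Rational as ℚ using (ℚ)

pow≢0 : ∀ b e → .{{NonZero b}} → NonZero (b ^ e)
pow≢0 b zero    = _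
pow≢0 b@(suc _) (suc e) = m*n≢0 b (b ^ e) {{_}} {{pow≢0 b e}}

sumTo : ℕ → (ℕ → ℚ) → ℚ
sumTo zero    f = f 0
sumTo (suc n) f = sumTo n f ℚ.+ f (suc n)

signPow : ℕ → ℤ
signPow k = (ℤ.- (+ 1)) ℤ.^ k

-- summand: C(n,k) C(n+k,k) C(2k,k) / ((-4)^k (k+1)),
-- written as ((-1)^k C(n,k) C(n+k,k) C(2k,k)) / (4^k (k+1)).
term : ℕ → ℕ → ℚ
term n k = ℚ._/_ (signPow k ℤ.* (+ ((n C k) * ((n + k) C k) * ((2 * k) C k))))
                 (4 ^ k * suc k) {{m*n≢0 (4 ^ k) (suc k) {{pow≢0 4 k}}}}

lhs : ℕ → ℚ
lhs n = sumTo n (term n)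

parityFactor : ℕ → ℚ
parityFactor n with n % 2
... | zero  = ℚ.1ℚ
... | suc _ = (+ n) ℚ./ suc n

rhs : ℕ → ℚ
rhs n = ℚ._/_ (+ (((2 * (n / 2)) C (n / 2)) ^ 2)) (16 ^ (n / 2)) {{pow≢0 16 (n / 2)}}
        ℚ.* parityFactor n

-- Creative telescoping (Zeilberger). Write t(n,k) for the summand and S(n) = Σₖ t(n,k). With
-- G(n,k) = −(4n+6) k² C(n+2,k) C(n+k,k) C(2k,k) (−1/4)^k,
--   (n+1)(n+2) [(n+2)(n+3) t(n+2,k) − (2n+3) t(n+1,k) − n(n+1) t(n,k)] = G(n,k+1) − G(n,k),
-- and G vanishes at k = 0 and k = n+3, so summing over k ≤ n+2 gives
--   (n+2)(n+3) S(n+2) = (2n+3) S(n+1) + n(n+1) S(n).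
-- The identity is a polynomial one, because t(n,k), t(n+1,k), t(n+2,k) and G(n,k+1) are all rational
-- multiples of C(n+2,k) C(n+k,k) C(2k,k) (−1/4)^k. The central term a(m) = C(2m,m)²/16^m satisfies
-- (2m+2)² a(m+1) = (2m+1)² a(m), and induction on m with the recurrence gives S(2m) = a(m) and
-- (2m+2) S(2m+1) = (2m+1) a(m).

module Submission where

open import Agda.Builtin.FromNat using (Number; fromNat)
open import Data.Integer as ℤ using (ℤ)
import Data.Integer.Tactic.RingSolver as ℤ-Solver
open import Data.Nat as ℕ using (ℕ; zero; suc; _∸_; _<_; s≤s; z≤n)
open import Data.Nat.Combinatorics using (_C_; k>n⇒nCk≡0; nC1≡n; nCk≡nC[n∸k]; nCk+nC[k+1]≡[n+1]C[k+1])
open import Data.Nat.Divisibility using (m∣m*n)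
open import Data.Nat.DivMod using (m*n/n≡m; m*n%n≡0; [m+kn]%n≡m%n; +-distrib-/-∣ʳ)
import Data.Nat.Literals as ℕLiterals
import Data.Nat.Properties as ℕ
import Data.Nat.Tactic.RingSolver as ℕ-Solver
open import Data.Product.Base using (_×_; _,_; proj₁; proj₂)
open import Data.Rational using (ℚ; _+_; _*_; -_; _-_; 0ℚ; _/_; 1/_)
open import Data.Rational.Literals as ℚLiterals using (fromℤ)
open import Data.Rational.Properties
  using (_≟_; +-*-commutativeRing; +-identityˡ; +-identityʳ; +-comm; +-assoc; *-distribˡ-+; *-zeroˡ; *-zeroʳ;
         *-assoc; *-identityˡ; *-identityʳ; *-inverseˡ; toℚᵘ-injective; toℚᵘ-homo-+; toℚᵘ-homo-*; toℚᵘ-fromℚᵘ)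
open import Data.Rational.Unnormalised as ℚᵘ using (*≡*; mkℚᵘ)
import Data.Rational.Unnormalised.Properties as ℚᵘ
open import Data.Unit.Base using (tt)
open import Level using (0ℓ)
open import Relation.Binary.PropositionalEquality
open import Relation.Nullary.Decidable using (dec⇒maybe)
open import Tactic.RingSolver using (solve-∀)
open import Tactic.RingSolver.Core.AlmostCommutativeRing using (AlmostCommutativeRing; fromCommutativeRing)

open import Defs

open ≡-Reasoning

-- Rational arithmetic

instance
  ℕ-number : Number ℕ
  ℕ-number = ℕLiterals.number

  ℚ-number : Number ℚ
  ℚ-number = ℚLiterals.number

-- A genuine zero test is needed: with a trivial one the solver's normal forms are not canonical
-- and it fails even on (x + y) * (x - y) ≡ x * x - y * y.
ℚ-ring : AlmostCommutativeRing 0ℓ 0ℓ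
ℚ-ring = fromCommutativeRing +-*-commutativeRing (λ x → dec⇒maybe (0ℚ ≟ x))

-- Recursive, so that fromℕ (suc n) is definitionally fromℕ n + 1; shifted indices therefore appear
-- below as N + 1 + 1 rather than N + 2.
fromℕ : ℕ → ℚ
fromℕ zero    = 0
fromℕ (suc n) = fromℕ n + 1

fromℕ-homo-+ : ∀ m n → fromℕ (m ℕ.+ n) ≡ fromℕ m + fromℕ n
fromℕ-homo-+ zero    n = sym (+-identityˡ (fromℕ n))
fromℕ-homo-+ (suc m) n = trans (cong (_+ 1) (fromℕ-homo-+ m n)) (shift (fromℕ m) (fromℕ n))
  where
  shift : ∀ x y → x + y + 1 ≡ x + 1 + y
  shift = solve-∀ ℚ-ring

fromℕ-homo-* : ∀ m n → fromℕ (m ℕ.* n) ≡ fromℕ m * fromℕ n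
fromℕ-homo-* zero    n = sym (*-zeroˡ (fromℕ n))
fromℕ-homo-* (suc m) n = trans (fromℕ-homo-+ n (m ℕ.* n))
  (trans (cong (λ x → fromℕ n + x) (fromℕ-homo-* m n)) (distrib (fromℕ m) (fromℕ n)))
  where
  distrib : ∀ x y → y + x * y ≡ (x + 1) * y
  distrib = solve-∀ ℚ-ring

fromℤ-homo-+ : ∀ i j → fromℤ (i ℤ.+ j) ≡ fromℤ i + fromℤ j
fromℤ-homo-+ i j = toℚᵘ-injective (ℚᵘ.≃-sym (ℚᵘ.≃-trans (toℚᵘ-homo-+ (fromℤ i) (fromℤ j)) (*≡* (denominators i j))))
  where
  denominators : ∀ i j → (i ℤ.* ℤ.+ 1 ℤ.+ j ℤ.* ℤ.+ 1) ℤ.* ℤ.+ 1 ≡ (i ℤ.+ j) ℤ.* (ℤ.+ 1 ℤ.* ℤ.+ 1)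
  denominators = ℤ-Solver.solve-∀

fromℤ-homo-* : ∀ i j → fromℤ (i ℤ.* j) ≡ fromℤ i * fromℤ j
fromℤ-homo-* i j = toℚᵘ-injective (ℚᵘ.≃-sym (toℚᵘ-homo-* (fromℤ i) (fromℤ j)))

fromℕ≡fromℤ : ∀ n → fromℕ n ≡ fromℤ (ℤ.+ n)
fromℕ≡fromℤ zero    = refl
fromℕ≡fromℤ (suc n) = trans (cong (_+ 1) (fromℕ≡fromℤ n))
  (trans (+-comm (fromℤ (ℤ.+ n)) 1) (sym (fromℤ-homo-+ (ℤ.+ 1) (ℤ.+ n))))

/-*-denominator : ∀ i d .{{_ : ℕ.NonZero d}} → (i / d) * fromℕ d ≡ fromℤ i
/-*-denominator i d@(suc e) = trans (cong ((i / d) *_) (fromℕ≡fromℤ d)) (toℚᵘ-injective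
  (ℚᵘ.≃-trans (toℚᵘ-homo-* (i / d) (fromℤ (ℤ.+ d)))
  (ℚᵘ.≃-trans (ℚᵘ.*-congʳ (toℚᵘ-fromℚᵘ (mkℚᵘ i e))) (*≡* (denominators i (ℤ.+ d))))))
  where
  denominators : ∀ i d → (i ℤ.* d) ℤ.* ℤ.+ 1 ≡ i ℤ.* (d ℤ.* ℤ.+ 1)
  denominators = ℤ-Solver.solve-∀

*-cancelˡ-fromℕ : ∀ {x y z} d .{{_ : ℕ.NonZero d}} → fromℕ d ≡ z → z * x ≡ z * y → x ≡ y
*-cancelˡ-fromℕ {x} {y} d refl eq = begin
  x                ≡⟨ undo x ⟩
  1/ z * (z * x)   ≡⟨ cong (1/ z *_) (subst (λ w → w * x ≡ w * y) (fromℕ≡fromℤ d) eq) ⟩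
  1/ z * (z * y)   ≡⟨ undo y ⟨
  y                ∎
  where
  z = fromℤ (ℤ.+ d)
  undo : ∀ w → w ≡ 1/ z * (z * w)
  undo w = sym (trans (sym (*-assoc (1/ z) z w)) (trans (cong (_* w) (*-inverseˡ z)) (*-identityˡ w)))

x+y≡z⇒x≡z-y : ∀ {x y z} → x + y ≡ z → x ≡ z - y
x+y≡z⇒x≡z-y {x} {y} refl = add-sub x y
  where
  add-sub : ∀ x y → x ≡ x + y - y
  add-sub = solve-∀ ℚ-ring

ratio-chain : ∀ a a′ b b′ {x y z : ℚ} → a * x ≡ a′ * y → b * y ≡ b′ * z → a * b * x ≡ a′ * b′ * z
ratio-chain a a′ b b′ {x} {y} {z} ax≡a′y by≡b′z = begin
  a * b * x       ≡⟨ exchange a b x ⟩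
  b * (a * x)     ≡⟨ cong (b *_) ax≡a′y ⟩
  b * (a′ * y)    ≡⟨ exchange′ b a′ y ⟩
  a′ * (b * y)    ≡⟨ cong (a′ *_) by≡b′z ⟩
  a′ * (b′ * z)   ≡⟨ *-assoc a′ b′ z ⟨
  a′ * b′ * z     ∎
  where
  exchange : ∀ a b x → a * b * x ≡ b * (a * x)
  exchange = solve-∀ ℚ-ring
  exchange′ : ∀ b a y → b * (a * y) ≡ a * (b * y)
  exchange′ = solve-∀ ℚ-ring

fromℕ-*-cong : ∀ a x b y → a ℕ.* x ≡ b ℕ.* y → fromℕ a * fromℕ x ≡ fromℕ b * fromℕ y
fromℕ-*-cong a x b y eq = trans (sym (fromℕ-homo-* a x)) (trans (cong fromℕ eq) (fromℕ-homo-* b y))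

-- Binomial coefficients

C-absorption : ∀ m k → suc k ℕ.* (suc m C suc k) ≡ suc m ℕ.* (m C k)
C-absorption zero    zero    = refl
C-absorption zero    (suc k) = trans (cong (suc (suc k) ℕ.*_) (k>n⇒nCk≡0 {1} {suc (suc k)} (s≤s (s≤s z≤n))))
  (trans (ℕ.*-zeroʳ (suc (suc k))) (cong (1 ℕ.*_) (sym (k>n⇒nCk≡0 {0} {suc k} (s≤s z≤n)))))
C-absorption (suc m) zero    = trans (ℕ.*-identityˡ _) (trans (nC1≡n (suc (suc m))) (sym (ℕ.*-identityʳ _)))
C-absorption (suc m) (suc k) = begin
  (2 ℕ.+ k) ℕ.* (suc (suc m) C suc (suc k))     ≡⟨ cong ((2 ℕ.+ k) ℕ.*_) (nCk+nC[k+1]≡[n+1]C[k+1] (suc m) (suc k)) ⟨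
  (2 ℕ.+ k) ℕ.* (a ℕ.+ b)                       ≡⟨ split k a b ⟩
  a ℕ.+ (1 ℕ.+ k) ℕ.* a ℕ.+ (2 ℕ.+ k) ℕ.* b     ≡⟨ cong₂ (λ x y → a ℕ.+ x ℕ.+ y) (C-absorption m k) (C-absorption m (suc k)) ⟩
  a ℕ.+ (1 ℕ.+ m) ℕ.* (m C k) ℕ.+ (1 ℕ.+ m) ℕ.* (m C suc k)   ≡⟨ factor a m (m C k) (m C suc k) ⟩
  a ℕ.+ (1 ℕ.+ m) ℕ.* ((m C k) ℕ.+ (m C suc k)) ≡⟨ cong (λ x → a ℕ.+ (1 ℕ.+ m) ℕ.* x) (nCk+nC[k+1]≡[n+1]C[k+1] m k) ⟩
  a ℕ.+ (1 ℕ.+ m) ℕ.* a                         ≡⟨⟩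
  (2 ℕ.+ m) ℕ.* a                               ∎
  where
  a = suc m C suc k
  b = suc m C suc (suc k)
  split : ∀ k a b → (2 ℕ.+ k) ℕ.* (a ℕ.+ b) ≡ a ℕ.+ (1 ℕ.+ k) ℕ.* a ℕ.+ (2 ℕ.+ k) ℕ.* b
  split = ℕ-Solver.solve-∀
  factor : ∀ a m x y → a ℕ.+ (1 ℕ.+ m) ℕ.* x ℕ.+ (1 ℕ.+ m) ℕ.* y ≡ a ℕ.+ (1 ℕ.+ m) ℕ.* (x ℕ.+ y)
  factor = ℕ-Solver.solve-∀

C-lower-step : ∀ m k → suc k ℕ.* (m C suc k) ℕ.+ k ℕ.* (m C k) ≡ m ℕ.* (m C k)
C-lower-step m k = ℕ.+-cancelʳ-≡ (m C k) _ _ (begin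
  suc k ℕ.* (m C suc k) ℕ.+ k ℕ.* (m C k) ℕ.+ (m C k)   ≡⟨ regroup k (m C suc k) (m C k) ⟩
  suc k ℕ.* ((m C k) ℕ.+ (m C suc k))                   ≡⟨ cong (suc k ℕ.*_) (nCk+nC[k+1]≡[n+1]C[k+1] m k) ⟩
  suc k ℕ.* (suc m C suc k)                             ≡⟨ C-absorption m k ⟩
  suc m ℕ.* (m C k)                                     ≡⟨ ℕ.+-comm (m C k) _ ⟩
  m ℕ.* (m C k) ℕ.+ (m C k)                             ∎)
  where
  regroup : ∀ k x y → (1 ℕ.+ k) ℕ.* x ℕ.+ k ℕ.* y ℕ.+ y ≡ (1 ℕ.+ k) ℕ.* (y ℕ.+ x)
  regroup = ℕ-Solver.solve-∀

C-central-symmetry : ∀ k → (suc (2 ℕ.* k) C k) ≡ (suc (2 ℕ.* k) C suc k)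
C-central-symmetry k = trans (nCk≡nC[n∸k] (ℕ.m≤n⇒m≤1+n (ℕ.m≤n*m k 2)))
  (cong (suc (2 ℕ.* k) C_) (trans (cong (_∸ k) (double k)) (ℕ.m+n∸m≡n k (suc k))))
  where
  double : ∀ k → suc (2 ℕ.* k) ≡ k ℕ.+ suc k
  double = ℕ-Solver.solve-∀

C-central-step : ∀ k → suc k ℕ.* (2 ℕ.* suc k C suc k) ≡ 2 ℕ.* suc (2 ℕ.* k) ℕ.* (2 ℕ.* k C k)
C-central-step k = begin
  suc k ℕ.* (2 ℕ.* suc k C suc k)               ≡⟨ cong (λ n → suc k ℕ.* (n C suc k)) (ℕ.*-suc 2 k) ⟩
  suc k ℕ.* (suc (suc (2 ℕ.* k)) C suc k)       ≡⟨ C-absorption (suc (2 ℕ.* k)) k ⟩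
  suc (suc (2 ℕ.* k)) ℕ.* (suc (2 ℕ.* k) C k)   ≡⟨ cong₂ ℕ._*_ (sym (ℕ.*-suc 2 k)) (C-central-symmetry k) ⟩
  2 ℕ.* suc k ℕ.* (suc (2 ℕ.* k) C suc k)       ≡⟨ ℕ.*-assoc 2 (suc k) (suc (2 ℕ.* k) C suc k) ⟩
  2 ℕ.* (suc k ℕ.* (suc (2 ℕ.* k) C suc k))     ≡⟨ cong (2 ℕ.*_) (C-absorption (2 ℕ.* k) k) ⟩
  2 ℕ.* (suc (2 ℕ.* k) ℕ.* (2 ℕ.* k C k))       ≡⟨ ℕ.*-assoc 2 (suc (2 ℕ.* k)) (2 ℕ.* k C k) ⟨
  2 ℕ.* suc (2 ℕ.* k) ℕ.* (2 ℕ.* k C k)         ∎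

infix 5 _Cℚ_

_Cℚ_ : ℕ → ℕ → ℚ
m Cℚ k = fromℕ (m C k)

Cℚ-absorption : ∀ m k → (fromℕ k + 1) * (suc m Cℚ suc k) ≡ (fromℕ m + 1) * (m Cℚ k)
Cℚ-absorption m k = fromℕ-*-cong (suc k) (suc m C suc k) (suc m) (m C k) (C-absorption m k)

Cℚ-lower-step : ∀ m k → (fromℕ k + 1) * (m Cℚ suc k) ≡ (fromℕ m - fromℕ k) * (m Cℚ k)
Cℚ-lower-step m k = trans (x+y≡z⇒x≡z-y sum) (factor (fromℕ m) (fromℕ k) (m Cℚ k))
  where
  sum : (fromℕ k + 1) * (m Cℚ suc k) + fromℕ k * (m Cℚ k) ≡ fromℕ m * (m Cℚ k)
  sum = begin
    (fromℕ k + 1) * (m Cℚ suc k) + fromℕ k * (m Cℚ k)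
      ≡⟨ cong₂ _+_ (fromℕ-homo-* (suc k) (m C suc k)) (fromℕ-homo-* k (m C k)) ⟨
    fromℕ (suc k ℕ.* (m C suc k)) + fromℕ (k ℕ.* (m C k))    ≡⟨ fromℕ-homo-+ (suc k ℕ.* (m C suc k)) (k ℕ.* (m C k)) ⟨
    fromℕ (suc k ℕ.* (m C suc k) ℕ.+ k ℕ.* (m C k))          ≡⟨ cong fromℕ (C-lower-step m k) ⟩
    fromℕ (m ℕ.* (m C k))                                     ≡⟨ fromℕ-homo-* m (m C k) ⟩
    fromℕ m * (m Cℚ k)                                        ∎
  factor : ∀ m k c → m * c - k * c ≡ (m - k) * c
  factor = solve-∀ ℚ-ring

Cℚ-upper-step : ∀ m k → (fromℕ m + 1) * (m Cℚ k) ≡ (fromℕ m + 1 - fromℕ k) * (suc m Cℚ k)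
Cℚ-upper-step m k = trans (sym (Cℚ-absorption m k)) (Cℚ-lower-step (suc m) k)

Cℚ-central-step : ∀ k → (fromℕ k + 1) * (2 ℕ.* suc k Cℚ suc k) ≡ 2 * (2 * fromℕ k + 1) * (2 ℕ.* k Cℚ k)
Cℚ-central-step k = begin
  (fromℕ k + 1) * (2 ℕ.* suc k Cℚ suc k)
    ≡⟨ fromℕ-*-cong (suc k) (2 ℕ.* suc k C suc k) (2 ℕ.* suc (2 ℕ.* k)) (2 ℕ.* k C k) (C-central-step k) ⟩
  fromℕ (2 ℕ.* suc (2 ℕ.* k)) * (2 ℕ.* k Cℚ k)         ≡⟨ cong (_* (2 ℕ.* k Cℚ k)) (fromℕ-homo-* 2 (suc (2 ℕ.* k))) ⟩
  2 * (fromℕ (2 ℕ.* k) + 1) * (2 ℕ.* k Cℚ k)           ≡⟨ cong (λ x → 2 * (x + 1) * (2 ℕ.* k Cℚ k)) (fromℕ-homo-* 2 k) ⟩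
  2 * (2 * fromℕ k + 1) * (2 ℕ.* k Cℚ k)               ∎

Cℚ-diagonal : ∀ n k → (fromℕ n + 1) * (suc n ℕ.+ k Cℚ k) ≡ (fromℕ n + 1 + fromℕ k) * (n ℕ.+ k Cℚ k)
Cℚ-diagonal n k = begin
  (fromℕ n + 1) * (suc n ℕ.+ k Cℚ k)             ≡⟨ cong (_* (suc n ℕ.+ k Cℚ k)) N+1≡ ⟩
  (fromℕ (n ℕ.+ k) + 1 - fromℕ k) * (suc n ℕ.+ k Cℚ k) ≡⟨ Cℚ-upper-step (n ℕ.+ k) k ⟨
  (fromℕ (n ℕ.+ k) + 1) * (n ℕ.+ k Cℚ k)         ≡⟨ cong (λ v → (v + 1) * (n ℕ.+ k Cℚ k)) (fromℕ-homo-+ n k) ⟩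
  (fromℕ n + fromℕ k + 1) * (n ℕ.+ k Cℚ k)       ≡⟨ cong (_* (n ℕ.+ k Cℚ k)) (swap (fromℕ n) (fromℕ k)) ⟩
  (fromℕ n + 1 + fromℕ k) * (n ℕ.+ k Cℚ k)       ∎
  where
  add-sub : ∀ N K → N + 1 ≡ N + K + 1 - K
  add-sub = solve-∀ ℚ-ring
  swap : ∀ N K → N + K + 1 ≡ N + 1 + K
  swap = solve-∀ ℚ-ring
  N+1≡ : fromℕ n + 1 ≡ fromℕ (n ℕ.+ k) + 1 - fromℕ k
  N+1≡ = trans (add-sub (fromℕ n) (fromℕ k)) (cong (λ v → v + 1 - fromℕ k) (sym (fromℕ-homo-+ n k)))

Cℚ-diagonal-suc : ∀ n k → (fromℕ k + 1) * (n ℕ.+ suc k Cℚ suc k) ≡ (fromℕ n + fromℕ k + 1) * (n ℕ.+ k Cℚ k)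
Cℚ-diagonal-suc n k = begin
  (fromℕ k + 1) * (n ℕ.+ suc k Cℚ suc k)     ≡⟨ cong (λ m → (fromℕ k + 1) * (m Cℚ suc k)) (ℕ.+-suc n k) ⟩
  (fromℕ k + 1) * (suc (n ℕ.+ k) Cℚ suc k)   ≡⟨ Cℚ-absorption (n ℕ.+ k) k ⟩
  (fromℕ (n ℕ.+ k) + 1) * (n ℕ.+ k Cℚ k)     ≡⟨ cong (λ v → (v + 1) * (n ℕ.+ k Cℚ k)) (fromℕ-homo-+ n k) ⟩
  (fromℕ n + fromℕ k + 1) * (n ℕ.+ k Cℚ k)   ∎

-- Finite sums

sumTo-cong : ∀ n {f g : ℕ → ℚ} → (∀ k → f k ≡ g k) → sumTo n f ≡ sumTo n g
sumTo-cong zero    f≡g = f≡g 0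
sumTo-cong (suc n) f≡g = cong₂ _+_ (sumTo-cong n f≡g) (f≡g (suc n))

sumTo-*ˡ : ∀ n c (f : ℕ → ℚ) → sumTo n (λ k → c * f k) ≡ c * sumTo n f
sumTo-*ˡ zero    c f = refl
sumTo-*ˡ (suc n) c f = trans (cong (_+ c * f (suc n)) (sumTo-*ˡ n c f))
                             (sym (*-distribˡ-+ c (sumTo n f) (f (suc n))))

sumTo-- : ∀ n (f g : ℕ → ℚ) → sumTo n (λ k → f k - g k) ≡ sumTo n f - sumTo n g
sumTo-- zero    f g = refl
sumTo-- (suc n) f g = trans (cong (_+ (f (suc n) - g (suc n))) (sumTo-- n f g))
                            (interchange (sumTo n f) (sumTo n g) (f (suc n)) (g (suc n)))
  where
  interchange : ∀ a b c d → a - b + (c - d) ≡ a + c - (b + d)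
  interchange = solve-∀ ℚ-ring

sumTo-telescope : ∀ n (G : ℕ → ℚ) → sumTo n (λ k → G (suc k) - G k) ≡ G (suc n) - G 0
sumTo-telescope zero    G = refl
sumTo-telescope (suc n) G = trans (cong (_+ (G (suc (suc n)) - G (suc n))) (sumTo-telescope n G))
                                  (cancel (G (suc (suc n))) (G (suc n)) (G 0))
  where
  cancel : ∀ a b c → b - c + (a - b) ≡ a - c
  cancel = solve-∀ ℚ-ring

sumTo-suc-vanishing : ∀ n (f : ℕ → ℚ) → f (suc n) ≡ 0 → sumTo (suc n) f ≡ sumTo n f
sumTo-suc-vanishing n f eq = trans (cong (sumTo n f +_) eq) (+-identityʳ (sumTo n f))

-- The summand and its hypergeometric kernel

weight : ℕ → ℚ
weight k = (signPow k / 4 ℕ.^ k) {{pow≢0 4 k}}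

weight-*-4^ : ∀ k → weight k * fromℕ (4 ℕ.^ k) ≡ fromℤ (signPow k)
weight-*-4^ k = /-*-denominator (signPow k) (4 ℕ.^ k) {{pow≢0 4 k}}

weight-suc : ∀ k → 4 * weight (suc k) ≡ - weight k
weight-suc k = *-cancelˡ-fromℕ (4 ℕ.^ suc k) {{pow≢0 4 (suc k)}} refl (begin
  fromℕ (4 ℕ.^ suc k) * (4 * weight (suc k))   ≡⟨ swap (fromℕ (4 ℕ.^ suc k)) (weight (suc k)) ⟩
  4 * (weight (suc k) * fromℕ (4 ℕ.^ suc k))   ≡⟨ cong (4 *_) (weight-*-4^ (suc k)) ⟩
  4 * fromℤ (signPow (suc k))                  ≡⟨ cong (4 *_) (fromℤ-homo-* (ℤ.- ℤ.+ 1) (signPow k)) ⟩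
  4 * (- 1 * fromℤ (signPow k))                ≡⟨ cong (λ x → 4 * (- 1 * x)) (weight-*-4^ k) ⟨
  4 * (- 1 * (weight k * F))                   ≡⟨ negate (weight k) F ⟩
  4 * F * (- weight k)                         ≡⟨ cong (_* - weight k) (fromℕ-homo-* 4 (4 ℕ.^ k)) ⟨
  fromℕ (4 ℕ.^ suc k) * (- weight k)           ∎)
  where
  F = fromℕ (4 ℕ.^ k)
  swap : ∀ x w → x * (4 * w) ≡ 4 * (w * x)
  swap = solve-∀ ℚ-ring
  negate : ∀ w x → 4 * (- 1 * (w * x)) ≡ 4 * x * (- w)
  negate = solve-∀ ℚ-ring

kernel : ℕ → ℕ → ℕ → ℚ
kernel a n k = weight k * ((a Cℚ k) * (n ℕ.+ k Cℚ k) * (2 ℕ.* k Cℚ k))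

term-factorised : ∀ n k → (fromℕ k + 1) * term n k ≡ kernel n n k
term-factorised n k = *-cancelˡ-fromℕ (4 ℕ.^ k) {{pow≢0 4 k}} refl (begin
  F * ((fromℕ k + 1) * term n k)                ≡⟨ rotate F (fromℕ k + 1) (term n k) ⟩
  term n k * (F * (fromℕ k + 1))                ≡⟨ cong (term n k *_) (fromℕ-homo-* (4 ℕ.^ k) (suc k)) ⟨
  term n k * fromℕ (4 ℕ.^ k ℕ.* suc k)
    ≡⟨ /-*-denominator (signPow k ℤ.* ℤ.+ B) (4 ℕ.^ k ℕ.* suc k) {{ℕ.m*n≢0 (4 ℕ.^ k) (suc k) {{pow≢0 4 k}}}} ⟩
  fromℤ (signPow k ℤ.* ℤ.+ B)                   ≡⟨ fromℤ-homo-* (signPow k) (ℤ.+ B) ⟩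
  fromℤ (signPow k) * fromℤ (ℤ.+ B)             ≡⟨ cong₂ _*_ (weight-*-4^ k) (fromℕ≡fromℤ B) ⟨
  weight k * F * fromℕ B                        ≡⟨ cong (weight k * F *_) binomials ⟩
  weight k * F * (a * b * c)                    ≡⟨ rotate′ (weight k) F (a * b * c) ⟩
  F * kernel n n k                              ∎)
  where
  F = fromℕ (4 ℕ.^ k)
  a = n Cℚ k
  b = n ℕ.+ k Cℚ k
  c = 2 ℕ.* k Cℚ k
  B = (n C k) ℕ.* ((n ℕ.+ k) C k) ℕ.* ((2 ℕ.* k) C k)
  binomials : fromℕ B ≡ a * b * c
  binomials = trans (fromℕ-homo-* ((n C k) ℕ.* ((n ℕ.+ k) C k)) ((2 ℕ.* k) C k))
                    (cong (_* c) (fromℕ-homo-* (n C k) ((n ℕ.+ k) C k)))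
  rotate : ∀ x y z → x * (y * z) ≡ z * (x * y)
  rotate = solve-∀ ℚ-ring
  rotate′ : ∀ w x y → w * x * y ≡ x * (w * y)
  rotate′ = solve-∀ ℚ-ring

term-vanishes : ∀ {n k} → n < k → term n k ≡ 0
term-vanishes {n} {k} n<k = *-cancelˡ-fromℕ (suc k) refl (begin
  (fromℕ k + 1) * term n k                  ≡⟨ term-factorised n k ⟩
  weight k * (fromℕ (n C k) * y * z)        ≡⟨ cong (λ x → weight k * (fromℕ x * y * z)) (k>n⇒nCk≡0 n<k) ⟩
  weight k * (0 * y * z)                    ≡⟨ annihilate (weight k) y z (fromℕ k) ⟩
  (fromℕ k + 1) * 0                         ∎)
  where
  y = n ℕ.+ k Cℚ k
  z = 2 ℕ.* k Cℚ k
  annihilate : ∀ w x y z → w * (0 * x * y) ≡ (z + 1) * 0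
  annihilate = solve-∀ ℚ-ring

kernel-upper : ∀ a n k → (fromℕ a + 1) * kernel a n k ≡ (fromℕ a + 1 - fromℕ k) * kernel (suc a) n k
kernel-upper a n k = begin
  (fromℕ a + 1) * (w * (x * y * z))            ≡⟨ into (fromℕ a + 1) w x y z ⟩
  w * ((fromℕ a + 1) * x * y * z)              ≡⟨ cong (λ v → w * (v * y * z)) (Cℚ-upper-step a k) ⟩
  w * ((fromℕ a + 1 - fromℕ k) * x′ * y * z)   ≡⟨ into (fromℕ a + 1 - fromℕ k) w x′ y z ⟨
  (fromℕ a + 1 - fromℕ k) * (w * (x′ * y * z)) ∎
  where
  w = weight k
  x = a Cℚ k
  x′ = suc a Cℚ k
  y = n ℕ.+ k Cℚ k
  z = 2 ℕ.* k Cℚ k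
  into : ∀ s w x y z → s * (w * (x * y * z)) ≡ w * (s * x * y * z)
  into = solve-∀ ℚ-ring

kernel-diagonal : ∀ a n k → (fromℕ n + 1) * kernel a (suc n) k ≡ (fromℕ n + 1 + fromℕ k) * kernel a n k
kernel-diagonal a n k = begin
  (fromℕ n + 1) * (w * (x * y′ * z))           ≡⟨ into (fromℕ n + 1) w x y′ z ⟩
  w * (x * ((fromℕ n + 1) * y′) * z)           ≡⟨ cong (λ v → w * (x * v * z)) (Cℚ-diagonal n k) ⟩
  w * (x * ((fromℕ n + 1 + fromℕ k) * y) * z)  ≡⟨ into (fromℕ n + 1 + fromℕ k) w x y z ⟨
  (fromℕ n + 1 + fromℕ k) * (w * (x * y * z))  ∎
  where
  w = weight k
  x = a Cℚ k
  y = n ℕ.+ k Cℚ k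
  y′ = suc n ℕ.+ k Cℚ k
  z = 2 ℕ.* k Cℚ k
  into : ∀ s w x y z → s * (w * (x * y * z)) ≡ w * (x * (s * y) * z)
  into = solve-∀ ℚ-ring

kernel-lower : ∀ a n k → 4 * (fromℕ k + 1) * (fromℕ k + 1) * (fromℕ k + 1) * kernel a n (suc k)
                    ≡ - ((fromℕ a - fromℕ k) * (fromℕ n + fromℕ k + 1) * (2 * (2 * fromℕ k + 1))) * kernel a n k
kernel-lower a n k = begin
  4 * K₁ * K₁ * K₁ * (weight (suc k) * (x′ * y′ * z′))
    ≡⟨ regroup 4 K₁ (weight (suc k)) x′ y′ z′ ⟩
  4 * weight (suc k) * (K₁ * x′ * (K₁ * y′) * (K₁ * z′))
    ≡⟨ cong₂ _*_ (weight-suc k) (cong₂ _*_ (cong₂ _*_ (Cℚ-lower-step a k) (Cℚ-diagonal-suc n k)) (Cℚ-central-step k)) ⟩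
  - weight k * ((fromℕ a - K) * x * ((fromℕ n + K + 1) * y) * (2 * (2 * K + 1) * z))
    ≡⟨ regroup′ (weight k) (fromℕ a - K) x (fromℕ n + K + 1) y (2 * (2 * K + 1)) z ⟩
  - ((fromℕ a - K) * (fromℕ n + K + 1) * (2 * (2 * K + 1))) * (weight k * (x * y * z))
    ∎
  where
  K = fromℕ k
  K₁ = fromℕ k + 1
  x = a Cℚ k
  x′ = a Cℚ suc k
  y = n ℕ.+ k Cℚ k
  y′ = n ℕ.+ suc k Cℚ suc k
  z = 2 ℕ.* k Cℚ k
  z′ = 2 ℕ.* suc k Cℚ suc k
  regroup : ∀ c s w x y z → c * s * s * s * (w * (x * y * z)) ≡ c * w * (s * x * (s * y) * (s * z))
  regroup = solve-∀ ℚ-ring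
  regroup′ : ∀ w p x q y r z → - w * (p * x * (q * y) * (r * z)) ≡ - (p * q * r) * (w * (x * y * z))
  regroup′ = solve-∀ ℚ-ring

-- Creative telescoping

shiftCombination : ℕ → ℕ → ℚ
shiftCombination n k = (fromℕ n + 2) * (fromℕ n + 3) * term (2 ℕ.+ n) k
                     - (2 * fromℕ n + 3) * term (suc n) k
                     - fromℕ n * (fromℕ n + 1) * term n k

certificate : ℕ → ℕ → ℚ
certificate n k = - (4 * fromℕ n + 6) * (fromℕ k * fromℕ k) * kernel (2 ℕ.+ n) n k

telescoping-identity : ∀ N K X →
  4 * (K + 1) * (K + 1) * (((N + 2) * (N + 3) * ((N + 1 + 1 + K) * (N + 1 + K))
                            - (2 * N + 3) * ((N + 1 + 1 - K) * (N + 1 + K))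
                            - N * (N + 1) * ((N + 1 - K) * (N + 1 + 1 - K))) * X)
  ≡ - (4 * N + 6) * ((K + 1) * (K + 1)) * (- ((N + 1 + 1 - K) * (N + K + 1) * (2 * (2 * K + 1))) * X)
    + 4 * (K + 1) * (K + 1) * (K + 1) * ((4 * N + 6) * (K * K) * X)
telescoping-identity = solve-∀ ℚ-ring

module _ (n k : ℕ) where
  private
    N = fromℕ n
    K = fromℕ k
    X = kernel (2 ℕ.+ n) n k
    R = (N + 2) * (N + 3) * ((N + 1 + 1 + K) * (N + 1 + K))
        - (2 * N + 3) * ((N + 1 + 1 - K) * (N + 1 + K))
        - N * (N + 1) * ((N + 1 - K) * (N + 1 + 1 - K))

  term-kernel₀ : (N + 1) * (N + 1 + 1) * ((K + 1) * term n k) ≡ (N + 1 - K) * (N + 1 + 1 - K) * X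
  term-kernel₀ = trans (cong ((N + 1) * (N + 1 + 1) *_) (term-factorised n k))
                       (ratio-chain (N + 1) (N + 1 - K) (N + 1 + 1) (N + 1 + 1 - K)
                                    (kernel-upper n n k) (kernel-upper (suc n) n k))

  term-kernel₁ : (N + 1 + 1) * (N + 1) * ((K + 1) * term (suc n) k) ≡ (N + 1 + 1 - K) * (N + 1 + K) * X
  term-kernel₁ = trans (cong ((N + 1 + 1) * (N + 1) *_) (term-factorised (suc n) k))
                       (ratio-chain (N + 1 + 1) (N + 1 + 1 - K) (N + 1) (N + 1 + K)
                                    (kernel-upper (suc n) (suc n) k) (kernel-diagonal (2 ℕ.+ n) n k))

  term-kernel₂ : (N + 1 + 1) * (N + 1) * ((K + 1) * term (2 ℕ.+ n) k) ≡ (N + 1 + 1 + K) * (N + 1 + K) * X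
  term-kernel₂ = trans (cong ((N + 1 + 1) * (N + 1) *_) (term-factorised (2 ℕ.+ n) k))
                       (ratio-chain (N + 1 + 1) (N + 1 + 1 + K) (N + 1) (N + 1 + K)
                                    (kernel-diagonal (2 ℕ.+ n) (suc n) k) (kernel-diagonal (2 ℕ.+ n) n k))

  shiftCombination-kernel : (K + 1) * ((N + 1) * (N + 2) * shiftCombination n k) ≡ R * X
  shiftCombination-kernel = begin
    (K + 1) * ((N + 1) * (N + 2) * shiftCombination n k)   ≡⟨ expose N K (term (2 ℕ.+ n) k) (term (suc n) k) (term n k) ⟩
    combine s₂ s₁ s₀                                      ≡⟨ cong₂ (λ u v → combine u v s₀) term-kernel₂ term-kernel₁ ⟩
    combine P₂ P₁ s₀                                      ≡⟨ cong (combine P₂ P₁) term-kernel₀ ⟩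
    combine P₂ P₁ P₀                                      ≡⟨ factor N K X ⟩
    R * X                                                 ∎
    where
    s₀ = (N + 1) * (N + 1 + 1) * ((K + 1) * term n k)
    s₁ = (N + 1 + 1) * (N + 1) * ((K + 1) * term (suc n) k)
    s₂ = (N + 1 + 1) * (N + 1) * ((K + 1) * term (2 ℕ.+ n) k)
    P₀ = (N + 1 - K) * (N + 1 + 1 - K) * X
    P₁ = (N + 1 + 1 - K) * (N + 1 + K) * X
    P₂ = (N + 1 + 1 + K) * (N + 1 + K) * X
    combine : ℚ → ℚ → ℚ → ℚ
    combine u v w = (N + 2) * (N + 3) * u - (2 * N + 3) * v - N * (N + 1) * w
    expose : ∀ N K t₂ t₁ t₀ →
      (K + 1) * ((N + 1) * (N + 2) * ((N + 2) * (N + 3) * t₂ - (2 * N + 3) * t₁ - N * (N + 1) * t₀))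
      ≡ (N + 2) * (N + 3) * ((N + 1 + 1) * (N + 1) * ((K + 1) * t₂))
        - (2 * N + 3) * ((N + 1 + 1) * (N + 1) * ((K + 1) * t₁))
        - N * (N + 1) * ((N + 1) * (N + 1 + 1) * ((K + 1) * t₀))
    expose = solve-∀ ℚ-ring
    factor : ∀ N K X →
      (N + 2) * (N + 3) * ((N + 1 + 1 + K) * (N + 1 + K) * X)
      - (2 * N + 3) * ((N + 1 + 1 - K) * (N + 1 + K) * X)
      - N * (N + 1) * ((N + 1 - K) * (N + 1 + 1 - K) * X)
      ≡ ((N + 2) * (N + 3) * ((N + 1 + 1 + K) * (N + 1 + K))
         - (2 * N + 3) * ((N + 1 + 1 - K) * (N + 1 + K))
         - N * (N + 1) * ((N + 1 - K) * (N + 1 + 1 - K))) * X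
    factor = solve-∀ ℚ-ring

  shiftCombination-telescopes : (N + 1) * (N + 2) * shiftCombination n k ≡ certificate n (suc k) - certificate n k
  shiftCombination-telescopes = *-cancelˡ-fromℕ (4 ℕ.* suc k ℕ.* suc k ℕ.* suc k) D-eq (begin
    D * ((N + 1) * (N + 2) * shiftCombination n k)
      ≡⟨ *-assoc (4 * K₁ * K₁) K₁ ((N + 1) * (N + 2) * shiftCombination n k) ⟩
    4 * K₁ * K₁ * (K₁ * ((N + 1) * (N + 2) * shiftCombination n k))
      ≡⟨ cong (4 * K₁ * K₁ *_) shiftCombination-kernel ⟩
    4 * K₁ * K₁ * (R * X)
      ≡⟨ telescoping-identity N K X ⟩
    - c * (K₁ * K₁) * (- ((N + 1 + 1 - K) * (N + K + 1) * (2 * (2 * K + 1))) * X) + D * (c * (K * K) * X)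
      ≡⟨ cong (λ u → - c * (K₁ * K₁) * u + D * (c * (K * K) * X)) (kernel-lower (2 ℕ.+ n) n k) ⟨
    - c * (K₁ * K₁) * (D * kernel (2 ℕ.+ n) n (suc k)) + D * (c * (K * K) * X)
      ≡⟨ collect c K D (kernel (2 ℕ.+ n) n (suc k)) X ⟩
    D * (certificate n (suc k) - certificate n k)
      ∎)
    where
    c = 4 * N + 6
    K₁ = K + 1
    D = 4 * K₁ * K₁ * K₁
    D-eq : fromℕ (4 ℕ.* suc k ℕ.* suc k ℕ.* suc k) ≡ D
    D-eq = trans (fromℕ-homo-* (4 ℕ.* suc k ℕ.* suc k) (suc k))
                 (cong (_* K₁) (trans (fromℕ-homo-* (4 ℕ.* suc k) (suc k)) (cong (_* K₁) (fromℕ-homo-* 4 (suc k)))))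
    collect : ∀ c K D Y X → - c * ((K + 1) * (K + 1)) * (D * Y) + D * (c * (K * K) * X)
                            ≡ D * (- c * ((K + 1) * (K + 1)) * Y - - c * (K * K) * X)
    collect = solve-∀ ℚ-ring

certificate-at-0 : ∀ n → certificate n 0 ≡ 0
certificate-at-0 n = vanish (4 * fromℕ n + 6) (kernel (2 ℕ.+ n) n 0)
  where
  vanish : ∀ c x → - c * (0 * 0) * x ≡ 0
  vanish = solve-∀ ℚ-ring

certificate-at-3+n : ∀ n → certificate n (3 ℕ.+ n) ≡ 0
certificate-at-3+n n =
  trans (cong (λ v → - (4 * fromℕ n + 6) * (K * K) * (weight k * (fromℕ v * y * z))) (k>n⇒nCk≡0 (ℕ.n<1+n (2 ℕ.+ n))))
        (vanish (4 * fromℕ n + 6) K (weight k) y z)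
  where
  k = 3 ℕ.+ n
  K = fromℕ k
  y = n ℕ.+ k Cℚ k
  z = 2 ℕ.* k Cℚ k
  vanish : ∀ c K w y z → - c * (K * K) * (w * (0 * y * z)) ≡ 0
  vanish = solve-∀ ℚ-ring

sumTo-shiftCombination : ∀ n → sumTo (2 ℕ.+ n) (shiftCombination n)
  ≡ (fromℕ n + 2) * (fromℕ n + 3) * lhs (2 ℕ.+ n) - (2 * fromℕ n + 3) * lhs (suc n) - fromℕ n * (fromℕ n + 1) * lhs n
sumTo-shiftCombination n = begin
  sumTo (2 ℕ.+ n) (shiftCombination n)
    ≡⟨ sumTo-- (2 ℕ.+ n) (λ k → a * T₂ k - b * T₁ k) (λ k → c * T₀ k) ⟩
  sumTo (2 ℕ.+ n) (λ k → a * T₂ k - b * T₁ k) - sumTo (2 ℕ.+ n) (λ k → c * T₀ k)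
    ≡⟨ cong (_- sumTo (2 ℕ.+ n) (λ k → c * T₀ k)) (sumTo-- (2 ℕ.+ n) (λ k → a * T₂ k) (λ k → b * T₁ k)) ⟩
  sumTo (2 ℕ.+ n) (λ k → a * T₂ k) - sumTo (2 ℕ.+ n) (λ k → b * T₁ k) - sumTo (2 ℕ.+ n) (λ k → c * T₀ k)
    ≡⟨ cong₂ _-_ (cong₂ _-_ (sumTo-*ˡ (2 ℕ.+ n) a T₂) (sumTo-*ˡ (2 ℕ.+ n) b T₁)) (sumTo-*ˡ (2 ℕ.+ n) c T₀) ⟩
  a * lhs (2 ℕ.+ n) - b * sumTo (2 ℕ.+ n) T₁ - c * sumTo (2 ℕ.+ n) T₀
    ≡⟨ cong₂ (λ u v → a * lhs (2 ℕ.+ n) - b * u - c * v) lhs-pad₁ lhs-pad₀ ⟩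
  a * lhs (2 ℕ.+ n) - b * lhs (suc n) - c * lhs n
    ∎
  where
  a = (fromℕ n + 2) * (fromℕ n + 3)
  b = 2 * fromℕ n + 3
  c = fromℕ n * (fromℕ n + 1)
  T₀ = term n
  T₁ = term (suc n)
  T₂ = term (2 ℕ.+ n)
  lhs-pad₁ : sumTo (2 ℕ.+ n) T₁ ≡ lhs (suc n)
  lhs-pad₁ = sumTo-suc-vanishing (suc n) T₁ (term-vanishes (ℕ.n<1+n (suc n)))
  lhs-pad₀ : sumTo (2 ℕ.+ n) T₀ ≡ lhs n
  lhs-pad₀ = trans (sumTo-suc-vanishing (suc n) T₀ (term-vanishes (ℕ.m<n⇒m<1+n (ℕ.n<1+n n))))
                   (sumTo-suc-vanishing n T₀ (term-vanishes (ℕ.n<1+n n)))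

sumTo-shiftCombination≡0 : ∀ n → sumTo (2 ℕ.+ n) (shiftCombination n) ≡ 0
sumTo-shiftCombination≡0 n = *-cancelˡ-fromℕ (suc n ℕ.* (2 ℕ.+ n)) scale (begin
  s * sumTo (2 ℕ.+ n) (shiftCombination n)                  ≡⟨ sumTo-*ˡ (2 ℕ.+ n) s (shiftCombination n) ⟨
  sumTo (2 ℕ.+ n) (λ k → s * shiftCombination n k)          ≡⟨ sumTo-cong (2 ℕ.+ n) (shiftCombination-telescopes n) ⟩
  sumTo (2 ℕ.+ n) (λ k → certificate n (suc k) - certificate n k)
                                                            ≡⟨ sumTo-telescope (2 ℕ.+ n) (certificate n) ⟩
  certificate n (3 ℕ.+ n) - certificate n 0                 ≡⟨ cong₂ _-_ (certificate-at-3+n n) (certificate-at-0 n) ⟩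
  0 - 0                                                     ≡⟨ *-zeroʳ s ⟨
  s * 0                                                     ∎)
  where
  s = (fromℕ n + 1) * (fromℕ n + 2)
  scale : fromℕ (suc n ℕ.* (2 ℕ.+ n)) ≡ s
  scale = trans (fromℕ-homo-* (suc n) (2 ℕ.+ n)) (cong ((fromℕ n + 1) *_) (+-assoc (fromℕ n) 1 1))

lhs-recurrence : ∀ n → (fromℕ n + 2) * (fromℕ n + 3) * lhs (2 ℕ.+ n)
                     ≡ (2 * fromℕ n + 3) * lhs (suc n) + fromℕ n * (fromℕ n + 1) * lhs n
lhs-recurrence n = difference-zero (trans (sym (sumTo-shiftCombination n)) (sumTo-shiftCombination≡0 n))
  where
  difference-zero : ∀ {x y z} → x - y - z ≡ 0 → x ≡ y + z
  difference-zero {x} {y} {z} eq = trans (split x y z) (trans (cong (_+ (y + z)) eq) (+-identityˡ (y + z)))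
    where
    split : ∀ x y z → x ≡ x - y - z + (y + z)
    split = solve-∀ ℚ-ring

-- The closed form

-- Syntactically the prefactor in rhs, so rhs n is definitionally centralSquare (n / 2) * parityFactor n.
centralSquare : ℕ → ℚ
centralSquare m = (ℤ.+ (((2 ℕ.* m) C m) ℕ.^ 2) / 16 ℕ.^ m) {{pow≢0 16 m}}

centralSquare-*-16^ : ∀ m → centralSquare m * fromℕ (16 ℕ.^ m) ≡ (2 ℕ.* m Cℚ m) * (2 ℕ.* m Cℚ m)
centralSquare-*-16^ m = begin
  centralSquare m * fromℕ (16 ℕ.^ m)   ≡⟨ /-*-denominator (ℤ.+ (c ℕ.^ 2)) (16 ℕ.^ m) {{pow≢0 16 m}} ⟩
  fromℤ (ℤ.+ (c ℕ.* (c ℕ.* 1)))       ≡⟨ fromℕ≡fromℤ (c ℕ.* (c ℕ.* 1)) ⟨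
  fromℕ (c ℕ.* (c ℕ.* 1))             ≡⟨ fromℕ-homo-* c (c ℕ.* 1) ⟩
  fromℕ c * fromℕ (c ℕ.* 1)           ≡⟨ cong (λ v → fromℕ c * fromℕ v) (ℕ.*-identityʳ c) ⟩
  fromℕ c * fromℕ c                   ∎
  where
  c = (2 ℕ.* m) C m

centralSquare-suc : ∀ m → (fromℕ (2 ℕ.* m) + 2) * (fromℕ (2 ℕ.* m) + 2) * centralSquare (suc m)
                        ≡ (fromℕ (2 ℕ.* m) + 1) * (fromℕ (2 ℕ.* m) + 1) * centralSquare m
centralSquare-suc m = *-cancelˡ-fromℕ (16 ℕ.^ suc m) {{pow≢0 16 (suc m)}} refl (begin
  F′ * ((N + 2) * (N + 2) * a′)                ≡⟨ pull F′ (N + 2) a′ ⟩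
  (N + 2) * (N + 2) * (a′ * F′)                ≡⟨ cong ((N + 2) * (N + 2) *_) (centralSquare-*-16^ (suc m)) ⟩
  (N + 2) * (N + 2) * (c′ * c′)                ≡⟨ square (N + 2) c′ ⟩
  ((N + 2) * c′) * ((N + 2) * c′)              ≡⟨ cong (λ v → v * v) central-step ⟩
  (4 * (N + 1) * c) * (4 * (N + 1) * c)        ≡⟨ expand (N + 1) c ⟩
  16 * ((N + 1) * (N + 1) * (c * c))           ≡⟨ cong (λ v → 16 * ((N + 1) * (N + 1) * v)) (centralSquare-*-16^ m) ⟨
  16 * ((N + 1) * (N + 1) * (a * F))           ≡⟨ push (N + 1) a F ⟩
  16 * F * ((N + 1) * (N + 1) * a)             ≡⟨ cong (_* ((N + 1) * (N + 1) * a)) (fromℕ-homo-* 16 (16 ℕ.^ m)) ⟨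
  F′ * ((N + 1) * (N + 1) * a)                 ∎)
  where
  N = fromℕ (2 ℕ.* m)
  M = fromℕ m
  F = fromℕ (16 ℕ.^ m)
  F′ = fromℕ (16 ℕ.^ suc m)
  a = centralSquare m
  a′ = centralSquare (suc m)
  c = 2 ℕ.* m Cℚ m
  c′ = 2 ℕ.* suc m Cℚ suc m
  central-step : (N + 2) * c′ ≡ 4 * (N + 1) * c
  central-step = begin
    (N + 2) * c′                  ≡⟨ cong (λ v → (v + 2) * c′) (fromℕ-homo-* 2 m) ⟩
    (2 * M + 2) * c′              ≡⟨ halve M c′ ⟩
    2 * ((M + 1) * c′)            ≡⟨ cong (2 *_) (Cℚ-central-step m) ⟩
    2 * (2 * (2 * M + 1) * c)     ≡⟨ double M c ⟩
    4 * (2 * M + 1) * c           ≡⟨ cong (λ v → 4 * (v + 1) * c) (fromℕ-homo-* 2 m) ⟨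
    4 * (N + 1) * c               ∎
    where
    halve : ∀ M c → (2 * M + 2) * c ≡ 2 * ((M + 1) * c)
    halve = solve-∀ ℚ-ring
    double : ∀ M c → 2 * (2 * (2 * M + 1) * c) ≡ 4 * (2 * M + 1) * c
    double = solve-∀ ℚ-ring
  pull : ∀ x p y → x * (p * p * y) ≡ p * p * (y * x)
  pull = solve-∀ ℚ-ring
  square : ∀ p c → p * p * (c * c) ≡ (p * c) * (p * c)
  square = solve-∀ ℚ-ring
  expand : ∀ p c → (4 * p * c) * (4 * p * c) ≡ 16 * (p * p * (c * c))
  expand = solve-∀ ℚ-ring
  push : ∀ p a x → 16 * (p * p * (a * x)) ≡ 16 * x * (p * p * a)
  push = solve-∀ ℚ-ring

module _ (m : ℕ) where
  private
    N = fromℕ (2 ℕ.* m)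
    a = centralSquare m
    a′ = centralSquare (suc m)
    S₀ = lhs (2 ℕ.* m)
    S₁ = lhs (1 ℕ.+ 2 ℕ.* m)
    S₂ = lhs (2 ℕ.+ 2 ℕ.* m)
    S₃ = lhs (3 ℕ.+ 2 ℕ.* m)

  lhs-even-step : S₀ ≡ a → (N + 1 + 1) * S₁ ≡ (N + 1) * a → S₂ ≡ a′
  lhs-even-step S₀≡a S₁-odd = *-cancelˡ-fromℕ ((2 ℕ.+ 2 ℕ.* m) ℕ.* (2 ℕ.+ 2 ℕ.* m) ℕ.* (3 ℕ.+ 2 ℕ.* m)) scale (begin
    Z * S₂                                                     ≡⟨ even-expose N S₂ ⟩
    (N + 1 + 1) * ((N + 2) * (N + 3) * S₂)                     ≡⟨ cong ((N + 1 + 1) *_) (lhs-recurrence (2 ℕ.* m)) ⟩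
    (N + 1 + 1) * ((2 * N + 3) * S₁ + N * (N + 1) * S₀)        ≡⟨ even-distribute N S₁ S₀ ⟩
    (2 * N + 3) * ((N + 1 + 1) * S₁) + N * (N + 1) * (N + 1 + 1) * S₀
                                                               ≡⟨ cong₂ (λ u v → (2 * N + 3) * u + N * (N + 1) * (N + 1 + 1) * v) S₁-odd S₀≡a ⟩
    (2 * N + 3) * ((N + 1) * a) + N * (N + 1) * (N + 1 + 1) * a ≡⟨ even-collect N a ⟩
    (N + 1 + 1 + 1) * ((N + 1) * (N + 1) * a)                  ≡⟨ cong ((N + 1 + 1 + 1) *_) (centralSquare-suc m) ⟨
    (N + 1 + 1 + 1) * ((N + 2) * (N + 2) * a′)                 ≡⟨ even-close N a′ ⟩
    Z * a′                                                     ∎)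
    where
    Z = (N + 1 + 1) * (N + 1 + 1) * (N + 1 + 1 + 1)
    scale : fromℕ ((2 ℕ.+ 2 ℕ.* m) ℕ.* (2 ℕ.+ 2 ℕ.* m) ℕ.* (3 ℕ.+ 2 ℕ.* m)) ≡ Z
    scale = trans (fromℕ-homo-* ((2 ℕ.+ 2 ℕ.* m) ℕ.* (2 ℕ.+ 2 ℕ.* m)) (3 ℕ.+ 2 ℕ.* m))
                  (cong (_* (N + 1 + 1 + 1)) (fromℕ-homo-* (2 ℕ.+ 2 ℕ.* m) (2 ℕ.+ 2 ℕ.* m)))
    even-expose : ∀ N S → (N + 1 + 1) * (N + 1 + 1) * (N + 1 + 1 + 1) * S ≡ (N + 1 + 1) * ((N + 2) * (N + 3) * S)
    even-expose = solve-∀ ℚ-ring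
    even-distribute : ∀ N S₁ S₀ → (N + 1 + 1) * ((2 * N + 3) * S₁ + N * (N + 1) * S₀)
                                  ≡ (2 * N + 3) * ((N + 1 + 1) * S₁) + N * (N + 1) * (N + 1 + 1) * S₀
    even-distribute = solve-∀ ℚ-ring
    even-collect : ∀ N a → (2 * N + 3) * ((N + 1) * a) + N * (N + 1) * (N + 1 + 1) * a ≡ (N + 1 + 1 + 1) * ((N + 1) * (N + 1) * a)
    even-collect = solve-∀ ℚ-ring
    even-close : ∀ N a → (N + 1 + 1 + 1) * ((N + 2) * (N + 2) * a) ≡ (N + 1 + 1) * (N + 1 + 1) * (N + 1 + 1 + 1) * a
    even-close = solve-∀ ℚ-ring

  lhs-odd-step : S₂ ≡ a′ → (N + 1 + 1) * S₁ ≡ (N + 1) * a → (N + 1 + 1 + 1 + 1) * S₃ ≡ (N + 1 + 1 + 1) * a′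
  lhs-odd-step S₂≡a′ S₁-odd = *-cancelˡ-fromℕ (3 ℕ.+ 2 ℕ.* m) refl (begin
    (N + 1 + 1 + 1) * ((N + 1 + 1 + 1 + 1) * S₃)                ≡⟨ odd-expose N S₃ ⟩
    (N + 1 + 2) * (N + 1 + 3) * S₃                              ≡⟨ lhs-recurrence (1 ℕ.+ 2 ℕ.* m) ⟩
    (2 * (N + 1) + 3) * S₂ + (N + 1) * (N + 1 + 1) * S₁         ≡⟨ cong ((2 * (N + 1) + 3) * S₂ +_) (*-assoc (N + 1) (N + 1 + 1) S₁) ⟩
    (2 * (N + 1) + 3) * S₂ + (N + 1) * ((N + 1 + 1) * S₁)       ≡⟨ cong₂ (λ u v → (2 * (N + 1) + 3) * u + (N + 1) * v) S₂≡a′ S₁-odd ⟩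
    (2 * (N + 1) + 3) * a′ + (N + 1) * ((N + 1) * a)            ≡⟨ cong ((2 * (N + 1) + 3) * a′ +_) (*-assoc (N + 1) (N + 1) a) ⟨
    (2 * (N + 1) + 3) * a′ + (N + 1) * (N + 1) * a              ≡⟨ cong ((2 * (N + 1) + 3) * a′ +_) (centralSquare-suc m) ⟨
    (2 * (N + 1) + 3) * a′ + (N + 2) * (N + 2) * a′             ≡⟨ odd-collect N a′ ⟩
    (N + 1 + 1 + 1) * ((N + 1 + 1 + 1) * a′)                    ∎)
    where
    odd-expose : ∀ N S → (N + 1 + 1 + 1) * ((N + 1 + 1 + 1 + 1) * S) ≡ (N + 1 + 2) * (N + 1 + 3) * S
    odd-expose = solve-∀ ℚ-ring
    odd-collect : ∀ N a → (2 * (N + 1) + 3) * a + (N + 2) * (N + 2) * a ≡ (N + 1 + 1 + 1) * ((N + 1 + 1 + 1) * a)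
    odd-collect = solve-∀ ℚ-ring

lhs-closed-form : ∀ m → lhs (2 ℕ.* m) ≡ centralSquare m
                      × fromℕ (2 ℕ.+ 2 ℕ.* m) * lhs (suc (2 ℕ.* m)) ≡ fromℕ (suc (2 ℕ.* m)) * centralSquare m
lhs-closed-form zero    = refl , refl
lhs-closed-form (suc m) = subst (λ n → lhs n ≡ a′ × fromℕ (2 ℕ.+ n) * lhs (suc n) ≡ fromℕ (suc n) * a′)
                                (sym (ℕ.*-suc 2 m)) (even , lhs-odd-step m even S₁-odd)
  where
  a′ = centralSquare (suc m)
  S₀≡a : lhs (2 ℕ.* m) ≡ centralSquare m
  S₀≡a = proj₁ (lhs-closed-form m)
  S₁-odd : fromℕ (2 ℕ.+ 2 ℕ.* m) * lhs (suc (2 ℕ.* m)) ≡ fromℕ (suc (2 ℕ.* m)) * centralSquare m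
  S₁-odd = proj₂ (lhs-closed-form m)
  even : lhs (2 ℕ.+ 2 ℕ.* m) ≡ a′
  even = lhs-even-step m S₀≡a S₁-odd

parityFactor-even : ∀ n → n ℕ.% 2 ≡ 0 → parityFactor n ≡ 1
parityFactor-even n n%2≡0 with n ℕ.% 2
... | zero = refl

parityFactor-odd : ∀ n → n ℕ.% 2 ≡ 1 → parityFactor n ≡ ℤ.+ n / suc n
parityFactor-odd n n%2≡1 with n ℕ.% 2
... | suc _ = refl

double-/2 : ∀ m → 2 ℕ.* m ℕ./ 2 ≡ m
double-/2 m = trans (cong (ℕ._/ 2) (ℕ.*-comm 2 m)) (m*n/n≡m m 2)

double-%2 : ∀ m → 2 ℕ.* m ℕ.% 2 ≡ 0
double-%2 m = trans (cong (ℕ._% 2) (ℕ.*-comm 2 m)) (m*n%n≡0 m 2)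

suc-double-/2 : ∀ m → suc (2 ℕ.* m) ℕ./ 2 ≡ m
suc-double-/2 m = trans (+-distrib-/-∣ʳ 1 {d = 2} (m∣m*n m)) (double-/2 m)

suc-double-%2 : ∀ m → suc (2 ℕ.* m) ℕ.% 2 ≡ 1
suc-double-%2 m = trans (cong (λ x → suc x ℕ.% 2) (ℕ.*-comm 2 m)) ([m+kn]%n≡m%n 1 m 2)

lhs≡rhs-even : ∀ m → lhs (2 ℕ.* m) ≡ rhs (2 ℕ.* m)
lhs≡rhs-even m = begin
  lhs (2 ℕ.* m)         ≡⟨ proj₁ (lhs-closed-form m) ⟩
  centralSquare m       ≡⟨ *-identityʳ (centralSquare m) ⟨
  centralSquare m * 1   ≡⟨ rhs-even ⟨
  rhs (2 ℕ.* m)         ∎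
  where
  rhs-even : rhs (2 ℕ.* m) ≡ centralSquare m * 1
  rhs-even = cong₂ (λ h p → centralSquare h * p) (double-/2 m) (parityFactor-even (2 ℕ.* m) (double-%2 m))

lhs≡rhs-odd : ∀ m → lhs (suc (2 ℕ.* m)) ≡ rhs (suc (2 ℕ.* m))
lhs≡rhs-odd m = *-cancelˡ-fromℕ (suc n) refl (begin
  D * lhs n           ≡⟨ proj₂ (lhs-closed-form m) ⟩
  fromℕ n * a         ≡⟨ cong (_* a) (trans (fromℕ≡fromℤ n) (sym (/-*-denominator (ℤ.+ n) (suc n)))) ⟩
  p * D * a           ≡⟨ rotate p D a ⟩
  D * (a * p)         ≡⟨ cong (D *_) rhs-odd ⟨
  D * rhs n           ∎)
  where
  n = suc (2 ℕ.* m)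
  D = fromℕ (suc n)
  a = centralSquare m
  p = ℤ.+ n / suc n
  rhs-odd : rhs n ≡ a * p
  rhs-odd = cong₂ (λ h q → centralSquare h * q) (suc-double-/2 m) (parityFactor-odd n (suc-double-%2 m))
  rotate : ∀ p d a → p * d * a ≡ d * (a * p)
  rotate = solve-∀ ℚ-ring

data EvenOdd : ℕ → Set where
  even : ∀ m → EvenOdd (2 ℕ.* m)
  odd  : ∀ m → EvenOdd (suc (2 ℕ.* m))

evenOdd : ∀ n → EvenOdd n
evenOdd zero = even 0
evenOdd (suc n) with evenOdd n
... | even m = odd m
... | odd m  = subst EvenOdd (ℕ.*-suc 2 m) (even (suc m))

mainTheorem2 : (n : ℕ) → lhs n ≡ rhs n
mainTheorem2 n with evenOdd n
... | even m = lhs≡rhs-even m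
... | odd m  = lhs≡rhs-odd m
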